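{- Let $(A,\precsim_A)$ and $(B,\precsim_B)$ be two disjoint partially ordered sets and let $\mathcal{P}\subseteq A\times B$ be any relation from $A$ to $B$. If $(A,\precsim_A)$ or $(B,\precsim_B)$ is a chain (totally ordered), then: (i) $\mathcal{P}$ is a causal biorder from $A$ to $B$; (ii) $\overline{\mathcal{P}}$ is a biorder from $A$ to $B$. In particular, (when one of the two sets is a chain) any communication from $A$ to $B$ is a causal biorder.
   Context: A relation $\mathcal{R}\subseteq A\times X$ is a biorder (Ferrers relation) from $A$ to $X$ if for all $a,b\in A$, $x,y\in X$: $(a\mathcal{R}x)\wedge(b\mathcal{R}y)\Rightarrow(a\mathcal{R}y)\vee(b\mathcal{R}x)$. For disjoint partially ordered sets $(A,\precsim_A)$, $(B,\precsim_B)$ and $\mathcal{P}\subseteq A\times B$, let $\rightarrow$ be the transitive closure of $\precsim_A\cup\precsim_B\cup\mathcal{P}$ on $A\cup B$ (the causal precedence). $\mathcal{P}$ is a causal biorder if for all $a,c\in A$, $b,d\in B$: $(a\mathcal{P}b)\wedge(c\mathcal{P}d)\Rightarrow (a\rightarrow d)\vee(c\rightarrow b)$. The relation $\overline{\mathcal{P}}$ from $A$ to $B$ is defined by $a\overline{\mathcal{P}}b$ iff there exist $a'\in A$, $b'\in B$ with $a\precsim_A a'$, $a'\mathcal{P}b'$, $b'\precsim_B b$ (i.e. $\overline{\mathcal{P}}=\precsim_A\circ\mathcal{P}\circ\precsim_B$). A communication from $A$ to $B$ is a finite relation $\mathcal{P}\subseteq A\times B$ such that whenever $(a,b)\in\mathcal{P}$: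 $(a',b)\in\mathcal{P}$ implies $a'=a$, and $(a,b')\in\mathcal{P}$ implies $b'=b$. -}

module Defs where

open import Level using (Level; _⊔_)
open import Data.Product using (_×_; _,_; ∃-syntax)
open import Data.Sum using (_⊎_; inj₁; inj₂)
open import Data.List using (List)
open import Data.List.Membership.Propositional using (_∈_)
open import Relation.Binary.PropositionalEquality using (_≡_)
open import Relation.Binary.Core using (Rel; REL)
open import Relation.Binary.Construct.Closure.Transitive using (TransClosure)

Biorder : ∀ {a x r} {A : Set a} {X : Set x} → REL A X r → Set (a ⊔ x ⊔ r)
Biorder {A = A} {X = X} R =
  ∀ (a b : A) (x y : X) → R a x → R b y → R a y ⊎ R b x

data Step {a b ℓ₁ ℓ₂ p} {A : Set a} {B : Set b}
          (≾A : Rel A ℓ₁) (≾B : Rel B ℓ₂) (P : REL A B p)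
          : Rel (A ⊎ B) (a ⊔ b ⊔ ℓ₁ ⊔ ℓ₂ ⊔ p) where
  stepA : ∀ {x y} → ≾A x y → Step ≾A ≾B P (inj₁ x) (inj₁ y)
  stepB : ∀ {x y} → ≾B x y → Step ≾A ≾B P (inj₂ x) (inj₂ y)
  stepP : ∀ {x y} → P x y → Step ≾A ≾B P (inj₁ x) (inj₂ y)

Causal : ∀ {a b ℓ₁ ℓ₂ p} {A : Set a} {B : Set b}
         (≾A : Rel A ℓ₁) (≾B : Rel B ℓ₂) (P : REL A B p) → Rel (A ⊎ B) _
Causal ≾A ≾B P = TransClosure (Step ≾A ≾B P)

CausalBiorder : ∀ {a b ℓ₁ ℓ₂ p} {A : Set a} {B : Set b}
         (≾A : Rel A ℓ₁) (≾B : Rel B ℓ₂) (P : REL A B p) → Set _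
CausalBiorder {A = A} {B = B} ≾A ≾B P =
  ∀ (a c : A) (b d : B) → P a b → P c d →
    Causal ≾A ≾B P (inj₁ a) (inj₂ d) ⊎ Causal ≾A ≾B P (inj₁ c) (inj₂ b)

closure : ∀ {a b ℓ₁ ℓ₂ p} {A : Set a} {B : Set b}
         (≾A : Rel A ℓ₁) (≾B : Rel B ℓ₂) (P : REL A B p) → REL A B _
closure {A = A} {B = B} ≾A ≾B P x y =
  ∃[ x' ] ∃[ y' ] (≾A x x' × P x' y' × ≾B y' y)

Communication : ∀ {a b p} {A : Set a} {B : Set b} → REL A B p → Set (a ⊔ b ⊔ p)
Communication {A = A} {B = B} P =
  (∃[ L ] (∀ x y → P x y → (x , y) ∈ L))
  × (∀ {x x' y} → P x y → P x' y → x' ≡ x)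
  × (∀ {x y y'} → P x y → P x y' → y' ≡ y)

{-# OPTIONS --safe #-}

-- Comparability on one side is all that is needed. For a P b and c P d with
-- a ≾ c, the path a ≾ c P d witnesses a → d; with b ≾ d, the path a P b ≾ d
-- does. For P̄, comparing the inner witnesses a' and c' (or b' and d') and
-- absorbing the comparison into the outer ≾ by transitivity gives the
-- Ferrers condition.

module Submission where

open import Defs
open import Level using (Level)
open import Data.Product using (_×_; _,_)
open import Data.Sum using (_⊎_; inj₁; inj₂; [_,_]′)
open import Relation.Binary.Core using (Rel; REL)
open import Relation.Binary.Definitions using (Total; Transitive)
open import Relation.Binary.Structures using (IsPartialOrder)
open import Relation.Binary.PropositionalEquality using (_≡_)
open import Relation.Binary.Construct.Closure.Transitive using ([_]; _∷_)

module _ {a b ℓ₁ ℓ₂ p} {A : Set a} {B : Set b}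
         {≾A : Rel A ℓ₁} {≾B : Rel B ℓ₂} {P : REL A B p} where

  causalBiorder-totalˡ : Total ≾A → CausalBiorder ≾A ≾B P
  causalBiorder-totalˡ total a c b d aPb cPd with total a c
  ... | inj₁ a≾c = inj₁ (stepA a≾c ∷ [ stepP cPd ])
  ... | inj₂ c≾a = inj₂ (stepA c≾a ∷ [ stepP aPb ])

  causalBiorder-totalʳ : Total ≾B → CausalBiorder ≾A ≾B P
  causalBiorder-totalʳ total a c b d aPb cPd with total b d
  ... | inj₁ b≾d = inj₁ (stepP aPb ∷ [ stepB b≾d ])
  ... | inj₂ d≾b = inj₂ (stepP cPd ∷ [ stepB d≾b ])

  causalBiorder-total : Total ≾A ⊎ Total ≾B → CausalBiorder ≾A ≾B P
  causalBiorder-total = [ causalBiorder-totalˡ , causalBiorder-totalʳ ]′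

  biorder-closure-totalˡ : Transitive ≾A → Total ≾A → Biorder (closure ≾A ≾B P)
  biorder-closure-totalˡ trans total _ _ _ _
    (a′ , b′ , a≾a′ , a′Pb′ , b′≾x) (c′ , d′ , c≾c′ , c′Pd′ , d′≾y)
    with total a′ c′
  ... | inj₁ a′≾c′ = inj₁ (c′ , d′ , trans a≾a′ a′≾c′ , c′Pd′ , d′≾y)
  ... | inj₂ c′≾a′ = inj₂ (a′ , b′ , trans c≾c′ c′≾a′ , a′Pb′ , b′≾x)

  biorder-closure-totalʳ : Transitive ≾B → Total ≾B → Biorder (closure ≾A ≾B P)
  biorder-closure-totalʳ trans total _ _ _ _
    (a′ , b′ , a≾a′ , a′Pb′ , b′≾x) (c′ , d′ , c≾c′ , c′Pd′ , d′≾y)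
    with total b′ d′
  ... | inj₁ b′≾d′ = inj₁ (a′ , b′ , a≾a′ , a′Pb′ , trans b′≾d′ d′≾y)
  ... | inj₂ d′≾b′ = inj₂ (c′ , d′ , c≾c′ , c′Pd′ , trans d′≾b′ b′≾x)

  biorder-closure-total : Transitive ≾A → Transitive ≾B →
                          Total ≾A ⊎ Total ≾B → Biorder (closure ≾A ≾B P)
  biorder-closure-total transA transB =
    [ biorder-closure-totalˡ transA , biorder-closure-totalʳ transB ]′

proposition28 : ∀ {a b ℓ₁ ℓ₂ p : Level} {A : Set a} {B : Set b}
    (≾A : Rel A ℓ₁) (≾B : Rel B ℓ₂) →
    IsPartialOrder _≡_ ≾A → IsPartialOrder _≡_ ≾B →
    (Total ≾A ⊎ Total ≾B) →
    (∀ (P : REL A B p) → CausalBiorder ≾A ≾B P × Biorder (closure ≾A ≾B P))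
    × (∀ (P : REL A B p) → Communication P → CausalBiorder ≾A ≾B P)
proposition28 ≾A ≾B poA poB total =
  (λ P → causalBiorder-total total , biorder-closure-total transA transB total) ,
  (λ P _ → causalBiorder-total total)
  where
  open IsPartialOrder poA using () renaming (trans to transA)
  open IsPartialOrder poB using () renaming (trans to transB)
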